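{- Let $G$ be a graph and $C$ a locally maximal cycle of $G$. Then $C$ is also a locally maximal cycle of the $C$-closure of $G$.
   Context: Graphs are simple and finite. A cycle $C$ in $G$ is locally maximal if there is no cycle $C'$ in $G$ with $|E(C')|>|E(C)|$ and $|E(C')\cap E(C,G-C)|\leq 2$, where $E(C,G-C)$ is the set of edges with exactly one endpoint in $V(C)$. The $m$-closure of a graph is obtained by recursively joining pairs of nonadjacent vertices whose degree sum (in the current graph) is at least $m$ until no such pair remains. For a cycle $C$ of length $c$, the $C$-closure of $G$ is obtained from $G$ by replacing $G[V(C)]$ by its $(c+1)$-closure. -}

module Defs where

open import Data.Nat using (ℕ; zero; suc; _+_; _≤_; _<_; _≥_)
open import Data.Nat.DivMod using (_%_; m%n<n)
open import Data.Fin using (Fin; toℕ; fromℕ<; _≟_)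
open import Data.Bool using (Bool; true; false; _∨_; _∧_; _xor_)
open import Data.List using (List; length; filterᵇ; allFin)
open import Data.Bool.ListAction using (any)
open import Data.Product using (Σ; _×_; ∃; ∃-syntax; _,_)
open import Relation.Nullary using (¬_)
open import Relation.Nullary.Decidable using (⌊_⌋)
open import Relation.Binary.PropositionalEquality using (_≡_; _≢_)
open import Relation.Binary.Construct.Closure.ReflexiveTransitive using (Star)

record Graph (n : ℕ) : Set where
  field
    adj    : Fin n → Fin n → Bool
    sym    : ∀ u v → adj u v ≡ adj v u
    irrefl : ∀ u → adj u u ≡ false
open Graph public

deg : ∀ {n} → Graph n → Fin n → ℕ
deg {n} G u = length (filterᵇ (adj G u) (allFin n))

Step : ∀ {n} → ℕ → Graph n → Graph n → Set
Step m G H =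
  ∃[ u ] ∃[ v ] (u ≢ v × adj G u v ≡ false × deg G u + deg G v ≥ m ×
    (∀ x y → adj H x y ≡
      (adj G x y ∨ ((⌊ x ≟ u ⌋ ∧ ⌊ y ≟ v ⌋) ∨ (⌊ x ≟ v ⌋ ∧ ⌊ y ≟ u ⌋)))))

Closed : ∀ {n} → ℕ → Graph n → Set
Closed m H = ∀ u v → u ≢ v → adj H u v ≡ false → deg H u + deg H v < m

IsClosure : ∀ {n} → ℕ → Graph n → Graph n → Set
IsClosure m G H = Star (Step m) G H × Closed m H

next : ∀ {k} → Fin k → Fin k
next {suc m} i = fromℕ< (m%n<n (suc (toℕ i)) (suc m))

record Cyc (n : ℕ) : Set where
  field
    len   : ℕ
    verts : Fin len → Fin n
open Cyc public

IsCycle : ∀ {n} → Graph n → Cyc n → Set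
IsCycle G C =
  3 ≤ len C ×
  (∀ i j → verts C i ≡ verts C j → i ≡ j) ×
  (∀ i → adj G (verts C i) (verts C (next i)) ≡ true)

inV : ∀ {n} → Cyc n → Fin n → Bool
inV C x = any (λ i → ⌊ verts C i ≟ x ⌋) (allFin (len C))

-- |E(C') ∩ E(C, G - C)|: edges of C' with exactly one endpoint in V(C)
crossing : ∀ {n} → Cyc n → Cyc n → ℕ
crossing C C' =
  length (filterᵇ (λ i → inV C (verts C' i) xor inV C (verts C' (next i)))
                  (allFin (len C')))

LocallyMaximal : ∀ {n} → Graph n → Cyc n → Set
LocallyMaximal {n} G C =
  IsCycle G C ×
  ¬ (Σ (Cyc n) λ C' → IsCycle G C' × len C < len C' × crossing C C' ≤ 2)

-- induced subgraph G[V(C)], with vertex i ↦ verts C i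
-- (C is assumed to have distinct vertices)
induced : ∀ {n} (G : Graph n) (C : Cyc n) → Graph (len C)
induced G C = record
  { adj    = λ i j → adj G (verts C i) (verts C j)
  ; sym    = λ i j → sym G (verts C i) (verts C j)
  ; irrefl = λ i → irrefl G (verts C i) }

IsCClosure : ∀ {n} → Graph n → Cyc n → Graph n → Set
IsCClosure G C H =
  Σ (Graph (len C)) λ K →
    IsClosure (suc (len C)) (induced G C) K ×
    (∀ i j → adj H (verts C i) (verts C j) ≡ adj K i j) ×
    (∀ x y → (inV C x ∧ inV C y) ≡ false → adj H x y ≡ adj G x y)

-- A closure step joins u, v ∈ V(C) with d(u) + d(v) ≥ c + 1, degrees taken in the current
-- graph on V(C). Suppose the new graph has a cycle D longer than C with at most two edges
-- crossing C. If D avoids uv it was already there; otherwise D − uv is a path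
-- x = p₀ … p_m = y with {x, y} = {u, v}, m ≥ c and at most two crossing edges. Send each
-- C-neighbour z of x to p_{j−1} if z = p_j and p_{j−1} ∈ V(C), to y if z = p_j and
-- p_{j−1} ∉ V(C), and to z itself if z is off the path. This is injective, since two indices
-- of the second kind would force four crossing edges, and it avoids the C-neighbours of y:
-- otherwise the rotation p_{j−1} … p₀ p_j … p_m or the insertion of z between y and x is a
-- cycle of the old graph, longer than C and crossing it at most twice. So d(u) + d(v) ≤ c.
module Submission where

open import Data.Bool using (Bool; true; false; not; _∧_; _∨_; _xor_; if_then_else_; T)
open import Data.Bool.Properties using (T-≡; T-∧; T-∨; ∧-identityʳ; ∧-zeroʳ; ∨-identityʳ; ∧-comm; ∨-comm; xor-comm)
import Data.Bool.Properties as Bool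
open import Data.Empty using (⊥; ⊥-elim)
open import Data.Fin using (Fin; zero; suc; toℕ; fromℕ<; _≟_)
open import Data.Fin.Properties using (toℕ-injective; toℕ-fromℕ<; toℕ<n)
import Data.Fin.Properties as Fin
open import Data.List using (length; filterᵇ; tabulate)
open import Data.List.Relation.Unary.Any.Properties using (any⁺; any⁻; tabulate⁺; tabulate⁻)
open import Data.Nat using (ℕ; zero; suc; _+_; _*_; _∸_; _≤_; _<_; _≡ᵇ_; z≤n; s≤s; z<s; s<s; s≤s⁻¹; NonZero)
open import Data.Nat.DivMod
open import Data.Nat.Properties hiding (_≟_)
open import Data.Product using (Σ; _×_; ∃; _,_)
open import Data.Sum using (_⊎_; inj₁; inj₂)
open import Function using (_∘_)
open import Function.Bundles using (Equivalence)
open import Relation.Binary.Construct.Closure.ReflexiveTransitive using (Star; ε; _◅_)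
open import Relation.Binary.Definitions using (tri<; tri≈; tri>)
open import Relation.Binary.PropositionalEquality
open import Relation.Nullary using (¬_; yes; no; contradiction)
open import Relation.Nullary.Decidable using (⌊_⌋; toWitness; fromWitness)
open import Defs hiding (sym)

-- Counting Boolean predicates on an initial segment of ℕ

count : ℕ → (ℕ → Bool) → ℕ
count zero    P = 0
count (suc k) P = if P 0 then suc (count k (P ∘ suc)) else count k (P ∘ suc)

count-cong : ∀ k {P Q : ℕ → Bool} → (∀ t → t < k → P t ≡ Q t) → count k P ≡ count k Q
count-cong zero    P≗Q = refl
count-cong (suc k) P≗Q =
  cong₂ (λ b r → if b then suc r else r) (P≗Q 0 z<s) (count-cong k (λ t t<k → P≗Q (suc t) (s<s t<k)))

count-not+count : ∀ k (P : ℕ → Bool) → count k (not ∘ P) + count k P ≡ k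
count-not+count zero    P = refl
count-not+count (suc k) P with P 0
... | true  = trans (+-suc _ _) (cong suc (count-not+count k (P ∘ suc)))
... | false = cong suc (count-not+count k (P ∘ suc))

_∖_ : (ℕ → Bool) → ℕ → ℕ → Bool
(P ∖ s) t = P t ∧ not (t ≡ᵇ s)

suc-count-∖ : ∀ k (P : ℕ → Bool) s → s < k → P s ≡ true → suc (count k (P ∖ s)) ≡ count k P
suc-count-∖ (suc k) P zero    _ P0 rewrite P0 =
  cong suc (count-cong k (λ t _ → ∧-identityʳ (P (suc t))))
suc-count-∖ (suc k) P (suc s) s<k Ps with P 0 | suc-count-∖ k (P ∘ suc) s (s≤s⁻¹ s<k) Ps
... | true  | IH = cong suc IH
... | false | IH = IH

MapsInto : ℕ → (ℕ → Bool) → ℕ → (ℕ → Bool) → (ℕ → ℕ) → Set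
MapsInto a P b Q h = ∀ t → t < a → P t ≡ true → h t < b × Q (h t) ≡ true

InjectiveOn : ℕ → (ℕ → Bool) → (ℕ → ℕ) → Set
InjectiveOn a P h = ∀ t t' → t < a → t' < a → P t ≡ true → P t' ≡ true → h t ≡ h t' → t ≡ t'

count-injection : ∀ a b {P Q : ℕ → Bool} (h : ℕ → ℕ) →
  MapsInto a P b Q h → InjectiveOn a P h → count a P ≤ count b Q
count-injection zero    b h into inj = z≤n
count-injection (suc a) b {P} {Q} h into inj with P 0 in P0
... | false = count-injection a b (h ∘ suc)
                (λ t t<a → into (suc t) (s<s t<a))
                (λ t t' t<a t'<a p p' e → suc-injective (inj (suc t) (suc t') (s<s t<a) (s<s t'<a) p p' e))
... | true  = let h0<b , Qh0 = into 0 z<s P0 in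
  subst (suc (count a (P ∘ suc)) ≤_) (suc-count-∖ b Q (h 0) h0<b Qh0)
    (s≤s (count-injection a b (h ∘ suc) into′
           (λ t t' t<a t'<a p p' e → suc-injective (inj (suc t) (suc t') (s<s t<a) (s<s t'<a) p p' e))))
  where
  into′ : MapsInto a (P ∘ suc) b (Q ∖ h 0) (h ∘ suc)
  into′ t t<a p with into (suc t) (s<s t<a) p | h (suc t) ≡ᵇ h 0 in e
  ... | h<b , Qh | false = h<b , cong (_∧ true) Qh
  ... | _ | true with () ← inj (suc t) 0 (s<s t<a) z<s p P0 (≡ᵇ⇒≡ _ _ (subst T (sym e) _))

length-filterᵇ-tabulate : ∀ {a} {A : Set a} k (f : Fin k → A) (Q : A → Bool) (P : ℕ → Bool) →
  (∀ i → Q (f i) ≡ P (toℕ i)) → length (filterᵇ Q (tabulate f)) ≡ count k P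
length-filterᵇ-tabulate zero    f Q P Q≗P = refl
length-filterᵇ-tabulate (suc k) f Q P Q≗P with Q (f zero) | P 0 | Q≗P zero
... | true  | .true  | refl = cong suc (length-filterᵇ-tabulate k (f ∘ suc) Q (P ∘ suc) (Q≗P ∘ suc))
... | false | .false | refl = length-filterᵇ-tabulate k (f ∘ suc) Q (P ∘ suc) (Q≗P ∘ suc)

-- Sequences indexed by ℕ

indexOf : ∀ {n} → ℕ → (ℕ → Fin n) → Fin n → ℕ
indexOf zero    f z = 0
indexOf (suc k) f z = if ⌊ f 0 ≟ z ⌋ then 0 else suc (indexOf k (f ∘ suc) z)

indexOf-< : ∀ {n} k (f : ℕ → Fin n) {z} t → t < k → f t ≡ z → indexOf k f z < k
indexOf-< (suc k) f {z} t t<k ft≡z with f 0 ≟ z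
... | yes _ = z<s
indexOf-< (suc k) f zero    t<k f0≡z | no f0≢z = contradiction f0≡z f0≢z
indexOf-< (suc k) f (suc t) t<k ft≡z | no _    = s<s (indexOf-< k (f ∘ suc) t (s≤s⁻¹ t<k) ft≡z)

indexOf-correct : ∀ {n} k (f : ℕ → Fin n) z → indexOf k f z < k → f (indexOf k f z) ≡ z
indexOf-correct (suc k) f z i<k with f 0 ≟ z
... | yes f0≡z = f0≡z
... | no _     = indexOf-correct k (f ∘ suc) z (s≤s⁻¹ i<k)

true-false-transition : (Q : ℕ → Bool) → ∀ {a b} → a ≤ b → Q a ≡ true → Q b ≡ false →
  ∃ λ i → a ≤ i × i < b × Q i ≡ true × Q (suc i) ≡ false
true-false-transition Q {a} {zero} z≤n Qa Qb = contradiction (trans (sym Qa) Qb) λ ()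
true-false-transition Q {a} {suc b} a≤b+1 Qa Qb with Q b in Qb′ | m≤n⇒m<n∨m≡n a≤b+1
... | _     | inj₂ refl = contradiction (trans (sym Qa) Qb) λ ()
... | true  | inj₁ a≤b = b , s≤s⁻¹ a≤b , n<1+n b , Qb′ , Qb
... | false | inj₁ a≤b with i , a≤i , i<b , Qi , Qi+1 ← true-false-transition Q (s≤s⁻¹ a≤b) Qa Qb′ =
  i , a≤i , m≤n⇒m≤1+n i<b , Qi , Qi+1

Increasing : ℕ → (ℕ → ℕ) → Set
Increasing a h = ∀ t → suc t < a → h t < h (suc t)

increasing-< : ∀ {a h} → Increasing a h → ∀ {s s'} → s < s' → s' < a → h s < h s'
increasing-< {h = h} step {s} {suc s'} (s≤s s≤s') s'+1<a with m≤n⇒m<n∨m≡n s≤s'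
... | inj₁ s<s' = <-trans (increasing-< step s<s' (<-trans (n<1+n s') s'+1<a)) (step s' s'+1<a)
... | inj₂ refl = step s s'+1<a

increasing⇒injective : ∀ {a h} → Increasing a h → ∀ t t' → t < a → t' < a → h t ≡ h t' → t ≡ t'
increasing⇒injective step t t' t<a t'<a e with <-cmp t t'
... | tri≈ _ t≡t' _ = t≡t'
... | tri< t<t' _ _ = contradiction e (<⇒≢ (increasing-< step t<t' t'<a))
... | tri> _ _ t'<t = contradiction (sym e) (<⇒≢ (increasing-< step t'<t t<a))

-- Cyclic indexing modulo m + 1

suc-%-self : ∀ m → suc m % suc m ≡ 0
suc-%-self m = n%n≡0 (suc m)

suc-%-< : ∀ {m t} → t < m → suc t % suc m ≡ suc t
suc-%-< t<m = m<n⇒m%n≡m (s≤s t<m)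

suc[m%n]%n≡suc[m]%n : ∀ m n .{{_ : NonZero n}} → suc (m % n) % n ≡ suc m % n
suc[m%n]%n≡suc[m]%n m n = begin
  (1 + m % n) % n            ≡⟨ %-distribˡ-+ 1 (m % n) n ⟩
  (1 % n + m % n % n) % n    ≡⟨ cong (λ r → (1 % n + r) % n) (m%n%n≡m%n m n) ⟩
  (1 % n + m % n) % n        ≡⟨ %-distribˡ-+ 1 m n ⟨
  (1 + m) % n                ∎
  where open ≡-Reasoning

[s+t]%n-cancelˡ : ∀ s {t t' m} → (s + t) % suc m ≡ (s + t') % suc m → t < suc m → t' < suc m → t ≡ t'
[s+t]%n-cancelˡ s {t} {t'} {m} e t<n t'<n = begin
  t                                 ≡⟨ m<n⇒m%n≡m t<n ⟨
  t % n                             ≡⟨ shift t ⟨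
  (s + t + s * m) % n               ≡⟨ %-distribˡ-+ (s + t) (s * m) n ⟩
  ((s + t) % n + s * m % n) % n     ≡⟨ cong (λ r → (r + s * m % n) % n) e ⟩
  ((s + t') % n + s * m % n) % n    ≡⟨ %-distribˡ-+ (s + t') (s * m) n ⟨
  (s + t' + s * m) % n              ≡⟨ shift t' ⟩
  t' % n                            ≡⟨ m<n⇒m%n≡m t'<n ⟩
  t'                                ∎
  where
  open ≡-Reasoning
  n = suc m
  shift : ∀ x → (s + x + s * m) % n ≡ x % n
  shift x = begin
    (s + x + s * m) % n   ≡⟨ cong (λ r → (r + s * m) % n) (+-comm s x) ⟩
    (x + s + s * m) % n   ≡⟨ cong (_% n) (+-assoc x s (s * m)) ⟩
    (x + (s + s * m)) % n ≡⟨ cong (λ r → (x + r) % n) (*-suc s m) ⟨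
    (x + s * n) % n       ≡⟨ [m+kn]%n≡m%n x s n ⟩
    x % n                 ∎

cyclic : ∀ {n} m → (Fin (suc m) → Fin n) → ℕ → Fin n
cyclic m f t = f (fromℕ< (m%n<n t (suc m)))

cyclic-% : ∀ {n} m (f : Fin (suc m) → Fin n) x y → x % suc m ≡ y % suc m → cyclic m f x ≡ cyclic m f y
cyclic-% m f x y x≡y = cong f (toℕ-injective (trans (toℕ-fromℕ< _) (trans x≡y (sym (toℕ-fromℕ< _)))))

cyclic-toℕ : ∀ {n} m (f : Fin (suc m) → Fin n) i → cyclic m f (toℕ i) ≡ f i
cyclic-toℕ m f i = cong f (toℕ-injective (trans (toℕ-fromℕ< _) (m<n⇒m%n≡m (toℕ<n i))))

cyclic-injective : ∀ {n} m (f : Fin (suc m) → Fin n) → (∀ i j → f i ≡ f j → i ≡ j) →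
  ∀ x y → cyclic m f x ≡ cyclic m f y → x % suc m ≡ y % suc m
cyclic-injective m f f-inj x y e =
  trans (sym (toℕ-fromℕ< _)) (trans (cong toℕ (f-inj _ _ e)) (toℕ-fromℕ< _))

cyclic-%-self : ∀ {n} m (f : Fin (suc m) → Fin n) x → cyclic m f (x % suc m) ≡ cyclic m f x
cyclic-%-self m f x = cyclic-% m f (x % suc m) x (m%n%n≡m%n x (suc m))

cyclic-suc-% : ∀ {n} m (f : Fin (suc m) → Fin n) x → cyclic m f (suc (x % suc m)) ≡ cyclic m f (suc x)
cyclic-suc-% m f x = cyclic-% m f (suc (x % suc m)) (suc x) (suc[m%n]%n≡suc[m]%n x (suc m))

cyclic-adjacent : ∀ {n} (G : Graph n) m (f : Fin (suc m) → Fin n) →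
  (∀ i → adj G (f i) (cyclic m f (suc (toℕ i))) ≡ true) →
  ∀ t → adj G (cyclic m f t) (cyclic m f (suc t)) ≡ true
cyclic-adjacent G m f edge t =
  subst (λ z → adj G (cyclic m f t) z ≡ true)
        (trans (cong (cyclic m f ∘ suc) (toℕ-fromℕ< (m%n<n t (suc m)))) (cyclic-suc-% m f t))
        (edge (fromℕ< (m%n<n t (suc m))))

-- Cycles and crossing edges

inV⇒verts : ∀ {n} (C : Cyc n) {x} → inV C x ≡ true → ∃ λ i → verts C i ≡ x
inV⇒verts C x∈C with i , eq ← tabulate⁻ (any⁻ _ _ (Equivalence.from T-≡ x∈C)) = i , toWitness eq

inV-verts : ∀ {n} (C : Cyc n) i → inV C (verts C i) ≡ true
inV-verts C i = Equivalence.to T-≡ (any⁺ _ (tabulate⁺ i (fromWitness refl)))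

crosses : ∀ {n} → Cyc n → Fin n → Fin n → Bool
crosses C x y = inV C x xor inV C y

NoLongerCycle : ∀ {n} → Graph n → Cyc n → Set
NoLongerCycle {n} G C = ¬ (Σ (Cyc n) λ D → IsCycle G D × len C < len D × crossing C D ≤ 2)

NoLongerCycle-cong : ∀ {n} {G H : Graph n} {C : Cyc n} → (∀ x y → adj H x y ≡ adj G x y) →
  NoLongerCycle G C → NoLongerCycle H C
NoLongerCycle-cong H≗G no-longer (D , (3≤len , inj , edge) , longer , few-crossings) =
  no-longer (D , (3≤len , inj , λ i → trans (sym (H≗G _ _)) (edge i)) , longer , few-crossings)

cycleOf : ∀ {n} m → (ℕ → Fin n) → Cyc n
cycleOf m g = record { len = suc m ; verts = g ∘ toℕ }

cycleOf-isCycle : ∀ {n} (G : Graph n) m (g : ℕ → Fin n) → 2 ≤ m →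
  (∀ t t' → t < suc m → t' < suc m → g t ≡ g t' → t ≡ t') →
  (∀ t → t < m → adj G (g t) (g (suc t)) ≡ true) → adj G (g m) (g 0) ≡ true →
  IsCycle G (cycleOf m g)
cycleOf-isCycle G m g 2≤m g-inj path closing =
  s≤s 2≤m , (λ i j e → toℕ-injective (g-inj _ _ (toℕ<n i) (toℕ<n j) e)) , edge
  where
  edge-from : ∀ t → t ≤ m → adj G (g t) (g (suc t % suc m)) ≡ true
  edge-from t t≤m with m≤n⇒m<n∨m≡n t≤m
  ... | inj₁ t<m  rewrite suc-%-< t<m   = path t t<m
  ... | inj₂ refl rewrite suc-%-self t = closing
  edge : ∀ i → adj G (g (toℕ i)) (g (toℕ (next i))) ≡ true
  edge i = subst (λ r → adj G (g (toℕ i)) (g r) ≡ true) (sym (toℕ-fromℕ< _))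
                 (edge-from (toℕ i) (s≤s⁻¹ (toℕ<n i)))

crossing-cycleOf : ∀ {n} (C : Cyc n) m (g : ℕ → Fin n) →
  crossing C (cycleOf m g) ≡ count (suc m) (λ t → crosses C (g t) (g (suc t % suc m)))
crossing-cycleOf C m g =
  length-filterᵇ-tabulate (suc m) (λ i → i) _ (λ t → crosses C (g t) (g (suc t % suc m)))
  (λ i → cong (crosses C (g (toℕ i)) ∘ g) (toℕ-fromℕ< _))

crossing-cyclic : ∀ {n} (C : Cyc n) m (f : Fin (suc m) → Fin n) →
  crossing C (record { len = suc m ; verts = f }) ≡
  count (suc m) (λ t → crosses C (cyclic m f t) (cyclic m f (suc t)))
crossing-cyclic C m f =
  length-filterᵇ-tabulate (suc m) (λ i → i) _ (λ t → crosses C (cyclic m f t) (cyclic m f (suc t)))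
  (λ i → cong (λ x → crosses C x (cyclic m f (suc (toℕ i)))) (sym (cyclic-toℕ m f i)))

-- Edges as unordered pairs

∨-∧-not-cancel : ∀ a b → (b ≡ true → a ≡ false) → (a ∨ b) ∧ not b ≡ a
∨-∧-not-cancel a false _   = trans (∧-identityʳ (a ∨ false)) (∨-identityʳ a)
∨-∧-not-cancel a true  b⇒¬a = trans (∧-zeroʳ (a ∨ true)) (sym (b⇒¬a refl))

sameEdge : ∀ {n} → Fin n → Fin n → Fin n → Fin n → Bool
sameEdge a b x y = (⌊ x ≟ a ⌋ ∧ ⌊ y ≟ b ⌋) ∨ (⌊ x ≟ b ⌋ ∧ ⌊ y ≟ a ⌋)

SameEdge : ∀ {n} → Fin n → Fin n → Fin n → Fin n → Set
SameEdge a b x y = (x ≡ a × y ≡ b) ⊎ (x ≡ b × y ≡ a)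

sameEdge⇒SameEdge : ∀ {n} (a b x y : Fin n) → sameEdge a b x y ≡ true → SameEdge a b x y
sameEdge⇒SameEdge a b x y e with Equivalence.to (T-∨ {⌊ x ≟ a ⌋ ∧ ⌊ y ≟ b ⌋}) (Equivalence.from T-≡ e)
... | inj₁ xa∧yb = let p , q = Equivalence.to (T-∧ {⌊ x ≟ a ⌋}) xa∧yb in inj₁ (toWitness p , toWitness q)
... | inj₂ xb∧ya = let p , q = Equivalence.to (T-∧ {⌊ x ≟ b ⌋}) xb∧ya in inj₂ (toWitness p , toWitness q)

SameEdge⇒sameEdge : ∀ {n} (a b x y : Fin n) → SameEdge a b x y → sameEdge a b x y ≡ true
SameEdge⇒sameEdge a b x y pair =
  Equivalence.to T-≡ (Equivalence.from (T-∨ {⌊ x ≟ a ⌋ ∧ ⌊ y ≟ b ⌋}) (witness pair))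
  where
  witness : SameEdge a b x y → T (⌊ x ≟ a ⌋ ∧ ⌊ y ≟ b ⌋) ⊎ T (⌊ x ≟ b ⌋ ∧ ⌊ y ≟ a ⌋)
  witness (inj₁ (p , q)) = inj₁ (Equivalence.from (T-∧ {⌊ x ≟ a ⌋}) (fromWitness p , fromWitness q))
  witness (inj₂ (p , q)) = inj₂ (Equivalence.from (T-∧ {⌊ x ≟ b ⌋}) (fromWitness p , fromWitness q))

sameEdge-swap : ∀ {n} (a b x y : Fin n) → sameEdge a b x y ≡ sameEdge a b y x
sameEdge-swap a b x y =
  trans (∨-comm (⌊ x ≟ a ⌋ ∧ ⌊ y ≟ b ⌋) _) (cong₂ _∨_ (∧-comm ⌊ x ≟ b ⌋ _) (∧-comm ⌊ x ≟ a ⌋ _))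

SameEdge-trans : ∀ {n} {a b x y x' y' : Fin n} → SameEdge a b x y → SameEdge a b x' y' → SameEdge x' y' x y
SameEdge-trans (inj₁ (refl , refl)) (inj₁ (refl , refl)) = inj₁ (refl , refl)
SameEdge-trans (inj₁ (refl , refl)) (inj₂ (refl , refl)) = inj₂ (refl , refl)
SameEdge-trans (inj₂ (refl , refl)) (inj₁ (refl , refl)) = inj₂ (refl , refl)
SameEdge-trans (inj₂ (refl , refl)) (inj₂ (refl , refl)) = inj₁ (refl , refl)

removeEdge : ∀ {n} → Graph n → Fin n → Fin n → Graph n
removeEdge G a b = record
  { adj    = λ x y → adj G x y ∧ not (sameEdge a b x y)
  ; sym    = λ x y → cong₂ (λ e p → e ∧ not p) (Graph.sym G x y) (sameEdge-swap a b x y)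
  ; irrefl = λ x → cong (_∧ _) (irrefl G x) }

-- One closure step

module OnCycle {n} (G : Graph n) {c₀ : ℕ} (cv : Fin (suc c₀) → Fin n)
               (cv-inj : ∀ i j → cv i ≡ cv j → i ≡ j) where

  c : ℕ
  c = suc c₀

  C : Cyc n
  C = record { len = c ; verts = cv }

  vertex : ℕ → Fin n
  vertex = cyclic c₀ cv

  vertex-inC : ∀ t → inV C (vertex t) ≡ true
  vertex-inC t = inV-verts C _

  vertex-injective : ∀ {t t'} → t < c → t' < c → vertex t ≡ vertex t' → t ≡ t'
  vertex-injective {t} {t'} t<c t'<c e = begin
    t      ≡⟨ m<n⇒m%n≡m t<c ⟨
    t % c  ≡⟨ cyclic-injective c₀ cv cv-inj t t' e ⟩
    t' % c ≡⟨ m<n⇒m%n≡m t'<c ⟩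
    t'     ∎
    where open ≡-Reasoning

  vertex-toℕ : ∀ i → vertex (toℕ i) ≡ cv i
  vertex-toℕ = cyclic-toℕ c₀ cv

  position : Fin n → ℕ
  position = indexOf c vertex

  position-correct : ∀ {z} → inV C z ≡ true → position z < c × vertex (position z) ≡ z
  position-correct {z} z∈C with i , cvi≡z ← inV⇒verts C z∈C =
    let pos<c = indexOf-< c vertex (toℕ i) (toℕ<n i) (trans (vertex-toℕ i) cvi≡z)
    in pos<c , indexOf-correct c vertex z pos<c

  neighbourOnC : Fin n → ℕ → Bool
  neighbourOnC a t = adj G a (vertex t)

  crosses-inside : ∀ {x y} → inV C x ≡ true → inV C y ≡ true → crosses C x y ≡ false
  crosses-inside x∈C y∈C rewrite x∈C | y∈C = refl

  module LongPath (no-longer : NoLongerCycle G C) (m : ℕ) (p : ℕ → Fin n) (2≤m : 2 ≤ m) (c≤m : c ≤ m)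
    (p-inj : ∀ t t' → t < suc m → t' < suc m → p t ≡ p t' → t ≡ t')
    (p-path : ∀ t → t < m → adj G (p t) (p (suc t)) ≡ true)
    (x y : Fin c) (p0 : p 0 ≡ cv x) (pm : p m ≡ cv y)
    (few-crossings : count m (λ t → crosses C (p t) (p (suc t))) ≤ 2) where

    p0∈C : inV C (p 0) ≡ true
    p0∈C = trans (cong (inV C) p0) (inV-verts C x)

    pm∈C : inV C (p m) ≡ true
    pm∈C = trans (cong (inV C) pm) (inV-verts C y)

    insertion : ∀ w → inV C w ≡ true → (∀ t → t < suc m → p t ≢ w) →
                adj G (cv x) w ≡ true → adj G (cv y) w ≡ true → ⊥
    insertion w w∈C w∉p x~w y~w = no-longer
      ( cycleOf (suc m) g
      , cycleOf-isCycle G (suc m) g (m≤n⇒m≤1+n 2≤m) g-inj g-path g-closing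
      , s≤s (m≤n⇒m≤1+n c≤m)
      , crossings )
      where
      g : ℕ → Fin n
      g t = if ⌊ t ≤? m ⌋ then p t else w

      g-≤ : ∀ {t} → t ≤ m → g t ≡ p t
      g-≤ {t} t≤m with t ≤? m
      ... | yes _  = refl
      ... | no t≰m = contradiction t≤m t≰m

      g-last : g (suc m) ≡ w
      g-last with suc m ≤? m
      ... | yes m<m = contradiction m<m (<-irrefl refl)
      ... | no _    = refl

      g-inj : ∀ t t' → t < suc (suc m) → t' < suc (suc m) → g t ≡ g t' → t ≡ t'
      g-inj t t' t<m+2 t'<m+2 e with m≤n⇒m<n∨m≡n (s≤s⁻¹ t<m+2) | m≤n⇒m<n∨m≡n (s≤s⁻¹ t'<m+2)
      ... | inj₁ t≤m  | inj₁ t'≤m =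
        p-inj t t' t≤m t'≤m (trans (sym (g-≤ (s≤s⁻¹ t≤m))) (trans e (g-≤ (s≤s⁻¹ t'≤m))))
      ... | inj₁ t≤m  | inj₂ refl =
        contradiction (trans (sym (g-≤ (s≤s⁻¹ t≤m))) (trans e g-last)) (w∉p t t≤m)
      ... | inj₂ refl | inj₁ t'≤m =
        contradiction (trans (sym (g-≤ (s≤s⁻¹ t'≤m))) (trans (sym e) g-last)) (w∉p t' t'≤m)
      ... | inj₂ refl | inj₂ refl = refl

      g-path : ∀ t → t < suc m → adj G (g t) (g (suc t)) ≡ true
      g-path t t<m+1 with m≤n⇒m<n∨m≡n (s≤s⁻¹ t<m+1)
      ... | inj₁ t<m  rewrite g-≤ (<⇒≤ t<m) | g-≤ t<m = p-path t t<m
      ... | inj₂ refl rewrite g-≤ (≤-refl {m}) | g-last | pm = y~w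

      g-closing : adj G (g (suc m)) (g 0) ≡ true
      g-closing rewrite g-last | g-≤ {0} z≤n | p0 = trans (Graph.sym G w (cv x)) x~w

      crossing-edge : ∀ t → t < suc (suc m) → crosses C (g t) (g (suc t % suc (suc m))) ≡ true →
                      t < m × crosses C (p t) (p (suc t)) ≡ true
      crossing-edge t t<m+2 e with m≤n⇒m<n∨m≡n (s≤s⁻¹ t<m+2)
      ... | inj₂ refl rewrite suc-%-self (suc m) | g-last | g-≤ {0} z≤n | crosses-inside w∈C p0∈C =
        contradiction e λ ()
      ... | inj₁ t≤m with m≤n⇒m<n∨m≡n (s≤s⁻¹ t≤m)
      ...   | inj₂ refl rewrite suc-%-< (n<1+n m) | g-≤ (≤-refl {m}) | g-last | crosses-inside pm∈C w∈C =
        contradiction e λ ()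
      ...   | inj₁ t<m rewrite suc-%-< (m<n⇒m<1+n t<m) | g-≤ (<⇒≤ t<m) | g-≤ t<m = t<m , e

      crossings : crossing C (cycleOf (suc m) g) ≤ 2
      crossings = begin
        crossing C (cycleOf (suc m) g)                                    ≡⟨ crossing-cycleOf C (suc m) g ⟩
        count (suc (suc m)) (λ t → crosses C (g t) (g (suc t % suc (suc m))))
          ≤⟨ count-injection _ m (λ t → t) crossing-edge (λ _ _ _ _ _ _ e → e) ⟩
        count m (λ t → crosses C (p t) (p (suc t)))                       ≤⟨ few-crossings ⟩
        2                                                                 ∎
        where open ≤-Reasoning

    rotation : ∀ i → i < m → inV C (p i) ≡ true → inV C (p (suc i)) ≡ true →
               adj G (cv x) (p (suc i)) ≡ true → adj G (cv y) (p i) ≡ true → ⊥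
    rotation i i<m pi∈C pi+1∈C x~pi+1 y~pi = no-longer
      ( cycleOf m g
      , cycleOf-isCycle G m g 2≤m g-inj g-path g-closing
      , s≤s c≤m
      , crossings )
      where
      reflect : ℕ → ℕ
      reflect t = if ⌊ t ≤? i ⌋ then i ∸ t else t

      reflect-≤ : ∀ {t} → t ≤ i → reflect t ≡ i ∸ t
      reflect-≤ {t} t≤i with t ≤? i
      ... | yes _  = refl
      ... | no t≰i = contradiction t≤i t≰i

      reflect-> : ∀ {t} → i < t → reflect t ≡ t
      reflect-> {t} i<t with t ≤? i
      ... | yes t≤i = contradiction (<-≤-trans i<t t≤i) (<-irrefl refl)
      ... | no _    = refl

      reflect-involutive : ∀ t → reflect (reflect t) ≡ t
      reflect-involutive t with ≤-<-connex t i
      ... | inj₁ t≤i = trans (cong reflect (reflect-≤ t≤i)) (trans (reflect-≤ (m∸n≤m i t)) (m∸[m∸n]≡n t≤i))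
      ... | inj₂ i<t = trans (cong reflect (reflect-> i<t)) (reflect-> i<t)

      reflect-< : ∀ {t} → t < suc m → reflect t < suc m
      reflect-< {t} t<m+1 with ≤-<-connex t i
      ... | inj₁ t≤i rewrite reflect-≤ t≤i = ≤-<-trans (m∸n≤m i t) (m<n⇒m<1+n i<m)
      ... | inj₂ i<t rewrite reflect-> i<t = t<m+1

      -- the cycle p i … p 0 p (i + 1) … p m
      g : ℕ → Fin n
      g = p ∘ reflect

      g-≤ : ∀ {t} → t ≤ i → g t ≡ p (i ∸ t)
      g-≤ = cong p ∘ reflect-≤

      g-> : ∀ {t} → i < t → g t ≡ p t
      g-> = cong p ∘ reflect->

      i∸t≡1+i∸[1+t] : ∀ {t} → t < i → i ∸ t ≡ suc (i ∸ suc t)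
      i∸t≡1+i∸[1+t] t<i = +-∸-assoc 1 t<i

      i∸[1+t]<i : ∀ {t} → t < i → i ∸ suc t < i
      i∸[1+t]<i {t} t<i = subst (_≤ i) (i∸t≡1+i∸[1+t] t<i) (m∸n≤m i t)

      g-inj : ∀ t t' → t < suc m → t' < suc m → g t ≡ g t' → t ≡ t'
      g-inj t t' t<m+1 t'<m+1 e = begin
        t                   ≡⟨ reflect-involutive t ⟨
        reflect (reflect t)  ≡⟨ cong reflect (p-inj _ _ (reflect-< t<m+1) (reflect-< t'<m+1) e) ⟩
        reflect (reflect t') ≡⟨ reflect-involutive t' ⟩
        t'                  ∎
        where open ≡-Reasoning

      g-path : ∀ t → t < m → adj G (g t) (g (suc t)) ≡ true
      g-path t t<m with <-cmp t i
      ... | tri< t<i _ _ rewrite g-≤ (<⇒≤ t<i) | g-≤ t<i | i∸t≡1+i∸[1+t] t<i =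
        trans (Graph.sym G _ _) (p-path _ (<-trans (i∸[1+t]<i t<i) i<m))
      ... | tri≈ _ refl _ rewrite g-≤ (≤-refl {i}) | g-> (n<1+n i) | n∸n≡0 i | p0 = x~pi+1
      ... | tri> _ _ i<t rewrite g-> i<t | g-> (m<n⇒m<1+n i<t) = p-path t t<m

      g-closing : adj G (g m) (g 0) ≡ true
      g-closing rewrite g-> i<m | g-≤ {0} z≤n | pm = y~pi

      edgeOf : ℕ → ℕ
      edgeOf t = if ⌊ t <? i ⌋ then i ∸ suc t else t

      edgeOf-< : ∀ {t} → t < i → edgeOf t ≡ i ∸ suc t
      edgeOf-< {t} t<i with t <? i
      ... | yes _  = refl
      ... | no t≮i = contradiction t<i t≮i

      edgeOf-≥ : ∀ {t} → i ≤ t → edgeOf t ≡ t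
      edgeOf-≥ {t} i≤t with t <? i
      ... | yes t<i = contradiction (<-≤-trans t<i i≤t) (<-irrefl refl)
      ... | no _    = refl

      edgeOf-involutive : ∀ t → edgeOf (edgeOf t) ≡ t
      edgeOf-involutive t with <-≤-connex t i
      ... | inj₁ t<i = begin
        edgeOf (edgeOf t)       ≡⟨ cong edgeOf (edgeOf-< t<i) ⟩
        edgeOf (i ∸ suc t)      ≡⟨ edgeOf-< (i∸[1+t]<i t<i) ⟩
        i ∸ suc (i ∸ suc t)     ≡⟨ cong (i ∸_) (i∸t≡1+i∸[1+t] t<i) ⟨
        i ∸ (i ∸ t)             ≡⟨ m∸[m∸n]≡n (<⇒≤ t<i) ⟩
        t                       ∎
        where open ≡-Reasoning
      ... | inj₂ i≤t = trans (cong edgeOf (edgeOf-≥ i≤t)) (edgeOf-≥ i≤t)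

      edgeOf-injective : ∀ t t' → edgeOf t ≡ edgeOf t' → t ≡ t'
      edgeOf-injective t t' e = trans (sym (edgeOf-involutive t)) (trans (cong edgeOf e) (edgeOf-involutive t'))

      crossing-edge : ∀ t → t < suc m → crosses C (g t) (g (suc t % suc m)) ≡ true →
                      edgeOf t < m × crosses C (p (edgeOf t)) (p (suc (edgeOf t))) ≡ true
      crossing-edge t t<m+1 e with m≤n⇒m<n∨m≡n (s≤s⁻¹ t<m+1)
      ... | inj₂ refl rewrite suc-%-self m | g-> i<m | g-≤ {0} z≤n | crosses-inside pm∈C pi∈C =
        contradiction e λ ()
      ... | inj₁ t<m rewrite suc-%-< t<m with <-cmp t i
      ...   | tri< t<i _ _ rewrite g-≤ (<⇒≤ t<i) | g-≤ t<i | i∸t≡1+i∸[1+t] t<i | edgeOf-< t<i =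
        <-trans (i∸[1+t]<i t<i) i<m , trans (xor-comm (inV C _) _) e
      ...   | tri≈ _ refl _ rewrite g-≤ (≤-refl {i}) | g-> (n<1+n i) | n∸n≡0 i | crosses-inside p0∈C pi+1∈C =
        contradiction e λ ()
      ...   | tri> _ _ i<t rewrite g-> i<t | g-> (m<n⇒m<1+n i<t) | edgeOf-≥ (<⇒≤ i<t) = t<m , e

      crossings : crossing C (cycleOf m g) ≤ 2
      crossings = begin
        crossing C (cycleOf m g)                                    ≡⟨ crossing-cycleOf C m g ⟩
        count (suc m) (λ t → crosses C (g t) (g (suc t % suc m)))
          ≤⟨ count-injection _ m edgeOf crossing-edge (λ t t' _ _ _ _ → edgeOf-injective t t') ⟩
        count m (λ t → crosses C (p t) (p (suc t)))                 ≤⟨ few-crossings ⟩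
        2                                                           ∎
        where open ≤-Reasoning

    single-reentry : ∀ {i₁ i₂} → i₁ < i₂ → i₂ < m →
      inV C (p i₁) ≡ false → inV C (p (suc i₁)) ≡ true →
      inV C (p i₂) ≡ false → inV C (p (suc i₂)) ≡ true → ⊥
    single-reentry {i₁} {i₂} i₁<i₂ i₂<m pi₁∉C pi₁+1∈C pi₂∉C pi₂+1∈C
      with e₁ , _ , e₁<i₁ , pe₁∈C , pe₁+1∉C ← true-false-transition (inV C ∘ p) z≤n p0∈C pi₁∉C
         | e₂ , i₁<e₂ , e₂<i₂ , pe₂∈C , pe₂+1∉C ← true-false-transition (inV C ∘ p) i₁<i₂ pi₁+1∈C pi₂∉C =
      contradiction (≤-trans four-crossings few-crossings) λ { (s≤s (s≤s ())) }
      where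
      -- the path starts in C, so each re-entry is preceded by an exit
      edge : ℕ → ℕ
      edge 0 = e₁
      edge 1 = i₁
      edge 2 = e₂
      edge _ = i₂

      edge-increasing : Increasing 4 edge
      edge-increasing 0 _ = e₁<i₁
      edge-increasing 1 _ = i₁<e₂
      edge-increasing 2 _ = e₂<i₂
      edge-increasing (suc (suc (suc _))) (s≤s (s≤s (s≤s (s≤s ()))))

      leaves : ∀ {t} → inV C (p t) ≡ true → inV C (p (suc t)) ≡ false → crosses C (p t) (p (suc t)) ≡ true
      leaves inside outside rewrite inside | outside = refl

      enters : ∀ {t} → inV C (p t) ≡ false → inV C (p (suc t)) ≡ true → crosses C (p t) (p (suc t)) ≡ true
      enters outside inside rewrite inside | outside = refl

      edge<m : ∀ t → t < 3 → edge t < m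
      edge<m t t<3 = <-trans (increasing-< edge-increasing t<3 ≤-refl) i₂<m

      edge-crosses : MapsInto 4 (λ _ → true) m (λ t → crosses C (p t) (p (suc t))) edge
      edge-crosses 0 _ _ = edge<m 0 (s≤s z≤n) , leaves pe₁∈C pe₁+1∉C
      edge-crosses 1 _ _ = edge<m 1 (s≤s (s≤s z≤n)) , enters pi₁∉C pi₁+1∈C
      edge-crosses 2 _ _ = edge<m 2 ≤-refl , leaves pe₂∈C pe₂+1∉C
      edge-crosses 3 _ _ = i₂<m , enters pi₂∉C pi₂+1∈C
      edge-crosses (suc (suc (suc (suc _)))) (s≤s (s≤s (s≤s (s≤s ())))) _

      four-crossings : 4 ≤ count m (λ t → crosses C (p t) (p (suc t)))
      four-crossings = count-injection 4 m edge edge-crosses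
        (λ t t' t<4 t'<4 _ _ → increasing⇒injective edge-increasing t t' t<4 t'<4)

    vertex⇒inC : ∀ t {a} → p a ≡ vertex t → inV C (p a) ≡ true
    vertex⇒inC t pa≡t = trans (cong (inV C) pa≡t) (vertex-inC t)

    pathIndex : Fin n → ℕ
    pathIndex = indexOf (suc m) p

    -- position 0 holds x itself, which is not a neighbour of x
    predecessorImage : ℕ → ℕ
    predecessorImage zero    = 0
    predecessorImage (suc i) = if inV C (p i) then position (p i) else toℕ y

    partner : ℕ → ℕ
    partner t = if ⌊ pathIndex (vertex t) <? suc m ⌋ then predecessorImage (pathIndex (vertex t)) else t

    partner-on : ∀ {t} → pathIndex (vertex t) < suc m → partner t ≡ predecessorImage (pathIndex (vertex t))
    partner-on {t} on with pathIndex (vertex t) <? suc m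
    ... | yes _  = refl
    ... | no off = contradiction on off

    partner-off : ∀ {t} → ¬ pathIndex (vertex t) < suc m → partner t ≡ t
    partner-off {t} off with pathIndex (vertex t) <? suc m
    ... | yes on = contradiction on off
    ... | no _   = refl

    data PartnerCase (t : ℕ) : Set where
      predecessor-on-C  : ∀ i → i < m → p (suc i) ≡ vertex t → inV C (p i) ≡ true →
                          partner t < c → vertex (partner t) ≡ p i → PartnerCase t
      predecessor-off-C : ∀ i → i < m → p (suc i) ≡ vertex t → inV C (p i) ≡ false →
                          partner t ≡ toℕ y → PartnerCase t
      off-path          : (∀ r → r < suc m → p r ≢ vertex t) → partner t ≡ t → PartnerCase t

    partnerCase : ∀ t → neighbourOnC (cv x) t ≡ true → PartnerCase t
    partnerCase t x~t with pathIndex (vertex t) <? suc m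
    ... | no off = off-path (λ r r<m+1 pr≡t → off (indexOf-< (suc m) p r r<m+1 pr≡t)) (partner-off off)
    ... | yes on = onPath (pathIndex (vertex t)) on (indexOf-correct (suc m) p (vertex t) on) (partner-on on)
      where
      onPath : ∀ j → j < suc m → p j ≡ vertex t → partner t ≡ predecessorImage j → PartnerCase t
      onPath zero    _ p0≡t _ =
        contradiction (trans (sym (irrefl G (cv x))) (trans (cong (adj G (cv x)) (trans (sym p0) p0≡t)) x~t)) λ ()
      onPath (suc i) i+1<m+1 pi+1≡t partner≡ with inV C (p i) in pi∈C
      ... | true  = let pos<c , v[pos]≡pi = position-correct pi∈C in
        predecessor-on-C i (s≤s⁻¹ i+1<m+1) pi+1≡t pi∈C (subst (_< c) (sym partner≡) pos<c)
                         (trans (cong vertex partner≡) v[pos]≡pi)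
      ... | false = predecessor-off-C i (s≤s⁻¹ i+1<m+1) pi+1≡t pi∈C partner≡

    partner-< : ∀ {t} → t < c → PartnerCase t → partner t < c
    partner-< _   (predecessor-on-C _ _ _ _ partner<c _) = partner<c
    partner-< _   (predecessor-off-C _ _ _ _ partner≡y)  = subst (_< c) (sym partner≡y) (toℕ<n y)
    partner-< t<c (off-path _ partner≡t)                 = subst (_< c) (sym partner≡t) t<c

    partner-avoids-N[y] : ∀ t → neighbourOnC (cv x) t ≡ true → PartnerCase t →
                          neighbourOnC (cv y) (partner t) ≡ false
    partner-avoids-N[y] t x~t case with neighbourOnC (cv y) (partner t) in y~partner
    ... | false = refl
    ... | true  = ⊥-elim (clash case)
      where
      clash : PartnerCase t → ⊥
      clash (predecessor-on-C i i<m pi+1≡t pi∈C _ v[partner]≡pi) =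
        rotation i i<m pi∈C (vertex⇒inC t pi+1≡t)
          (trans (cong (adj G (cv x)) pi+1≡t) x~t)
          (trans (cong (adj G (cv y)) (sym v[partner]≡pi)) y~partner)
      clash (predecessor-off-C _ _ _ _ partner≡y) = contradiction
        (trans (sym (irrefl G (cv y)))
               (trans (cong (adj G (cv y)) (sym (trans (cong vertex partner≡y) (vertex-toℕ y)))) y~partner))
        λ ()
      clash (off-path off partner≡t) =
        insertion (vertex t) (vertex-inC t) off x~t (trans (cong (adj G (cv y) ∘ vertex) (sym partner≡t)) y~partner)

    same-predecessor : ∀ {t t' i i'} → t < c → t' < c → p (suc i) ≡ vertex t → p (suc i') ≡ vertex t' →
                       i ≡ i' → t ≡ t'
    same-predecessor t<c t'<c pi+1≡t pi'+1≡t' refl = vertex-injective t<c t'<c (trans (sym pi+1≡t) pi'+1≡t')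

    on-C≢off-C : ∀ {t t' i} → i < m → vertex (partner t) ≡ p i → partner t' ≡ toℕ y → partner t ≢ partner t'
    on-C≢off-C i<m v[partner]≡pi partner≡y e = <⇒≢ i<m (p-inj _ m (m<n⇒m<1+n i<m) (n<1+n m)
      (trans (sym v[partner]≡pi) (trans (cong vertex (trans e partner≡y)) (trans (vertex-toℕ y) (sym pm)))))

    on-C≢off-path : ∀ {t t' i} → i < m → vertex (partner t) ≡ p i → (∀ r → r < suc m → p r ≢ vertex t') →
                    partner t' ≡ t' → partner t ≢ partner t'
    on-C≢off-path i<m v[partner]≡pi off partner≡t' e =
      off _ (m<n⇒m<1+n i<m) (trans (sym v[partner]≡pi) (cong vertex (trans e partner≡t')))

    off-C≢off-path : ∀ {t t'} → partner t ≡ toℕ y → (∀ r → r < suc m → p r ≢ vertex t') →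
                     partner t' ≡ t' → partner t ≢ partner t'
    off-C≢off-path partner≡y off partner≡t' e =
      off m (n<1+n m)
        (trans pm (trans (sym (vertex-toℕ y)) (cong vertex (trans (sym partner≡y) (trans e partner≡t')))))

    collide : ∀ {t t'} → t < c → t' < c → PartnerCase t → PartnerCase t' → partner t ≡ partner t' → t ≡ t'
    collide t<c t'<c (predecessor-on-C i i<m q _ _ v≡pi) (predecessor-on-C i' i'<m q' _ _ v≡pi') e =
      same-predecessor t<c t'<c q q'
        (p-inj i i' (m<n⇒m<1+n i<m) (m<n⇒m<1+n i'<m) (trans (sym v≡pi) (trans (cong vertex e) v≡pi')))
    collide _ _ (predecessor-on-C _ i<m _ _ _ v≡pi) (predecessor-off-C _ _ _ _ eq') e =
      ⊥-elim (on-C≢off-C i<m v≡pi eq' e)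
    collide _ _ (predecessor-on-C _ i<m _ _ _ v≡pi) (off-path off eq') e =
      ⊥-elim (on-C≢off-path i<m v≡pi off eq' e)
    collide _ _ (predecessor-off-C _ _ _ _ eq) (predecessor-on-C _ i'<m _ _ _ v≡pi') e =
      ⊥-elim (on-C≢off-C i'<m v≡pi' eq (sym e))
    collide {t} {t'} t<c t'<c (predecessor-off-C i i<m q pi∉C _) (predecessor-off-C i' i'<m q' pi'∉C _) _
      with <-cmp i i'
    ... | tri≈ _ i≡i' _ = same-predecessor t<c t'<c q q' i≡i'
    ... | tri< i<i' _ _ = ⊥-elim (single-reentry i<i' i'<m pi∉C (vertex⇒inC t q) pi'∉C (vertex⇒inC t' q'))
    ... | tri> _ _ i'<i = ⊥-elim (single-reentry i'<i i<m pi'∉C (vertex⇒inC t' q') pi∉C (vertex⇒inC t q))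
    collide _ _ (predecessor-off-C _ _ _ _ eq) (off-path off eq') e =
      ⊥-elim (off-C≢off-path eq off eq' e)
    collide _ _ (off-path off eq) (predecessor-on-C _ i'<m _ _ _ v≡pi') e =
      ⊥-elim (on-C≢off-path i'<m v≡pi' off eq (sym e))
    collide _ _ (off-path off eq) (predecessor-off-C _ _ _ _ eq') e =
      ⊥-elim (off-C≢off-path eq' off eq (sym e))
    collide _ _ (off-path _ eq) (off-path _ eq') e = trans (sym eq) (trans e eq')

    degree-sum-≤ : count c (neighbourOnC (cv x)) + count c (neighbourOnC (cv y)) ≤ c
    degree-sum-≤ = begin
      count c N[x] + count c N[y]
        ≤⟨ +-monoˡ-≤ (count c N[y]) (count-injection c c {N[x]} {not ∘ N[y]} partner into injective) ⟩
      count c (not ∘ N[y]) + count c N[y] ≡⟨ count-not+count c N[y] ⟩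
      c                                   ∎
      where
      open ≤-Reasoning
      N[x] N[y] : ℕ → Bool
      N[x] = neighbourOnC (cv x)
      N[y] = neighbourOnC (cv y)
      into : MapsInto c N[x] c (not ∘ N[y]) partner
      into t t<c x~t = let case = partnerCase t x~t in
        partner-< t<c case , cong not (partner-avoids-N[y] t x~t case)
      injective : InjectiveOn c N[x] partner
      injective t t' t<c t'<c x~t x~t' = collide t<c t'<c (partnerCase t x~t) (partnerCase t' x~t')

  longer-cycle-through-edge⇒degree-sum-≤ : NoLongerCycle G C → ∀ (u v : Fin c) (H : Graph n) →
    (∀ a b → adj H a b ≡ true → adj G a b ≡ true ⊎ SameEdge (cv u) (cv v) a b) →
    ∀ {m} (f : Fin (suc m) → Fin n) → IsCycle H (record { len = suc m ; verts = f }) → c < suc m →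
    crossing C (record { len = suc m ; verts = f }) ≤ 2 →
    ∀ i₀ → SameEdge (cv u) (cv v) (f i₀) (cyclic m f (suc (toℕ i₀))) →
    count c (neighbourOnC (cv u)) + count c (neighbourOnC (cv v)) ≤ c
  longer-cycle-through-edge⇒degree-sum-≤ no-longer u v H H⊆G+uv {m} f (3≤m+1 , f-inj , f-edge) c<m+1 D-crossings
                                         i₀ uv-edge =
    orient uv-edge′
    where
    s : ℕ
    s = suc (toℕ i₀)

    p : ℕ → Fin n
    p t = cyclic m f (s + t)

    pm≡fi₀ : p m ≡ f i₀
    pm≡fi₀ = trans (cyclic-% m f (s + m) (toℕ i₀) (trans (cong (_% suc m) (sym (+-suc (toℕ i₀) m)))
                                                          ([m+n]%n≡m%n (toℕ i₀) (suc m))))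
                   (cyclic-toℕ m f i₀)

    uv-edge′ : SameEdge (cv u) (cv v) (p m) (p 0)
    uv-edge′ = subst₂ (SameEdge (cv u) (cv v)) (sym pm≡fi₀) (cong (cyclic m f) (sym (+-identityʳ s))) uv-edge

    2≤m : 2 ≤ m
    2≤m = s≤s⁻¹ 3≤m+1

    p-inj : ∀ t t' → t < suc m → t' < suc m → p t ≡ p t' → t ≡ t'
    p-inj t t' t<m+1 t'<m+1 e = [s+t]%n-cancelˡ s (cyclic-injective m f f-inj (s + t) (s + t') e) t<m+1 t'<m+1

    p-adjacent : ∀ t → adj H (p t) (p (suc t)) ≡ true
    p-adjacent t = subst (λ z → adj H (p t) (cyclic m f z) ≡ true) (sym (+-suc s t))
                         (cyclic-adjacent H m f f-edge (s + t))

    p-path : ∀ t → t < m → adj G (p t) (p (suc t)) ≡ true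
    p-path t t<m with H⊆G+uv _ _ (p-adjacent t)
    ... | inj₁ in-G = in-G
    ... | inj₂ uv-step with SameEdge-trans uv-step uv-edge′
    ...   | inj₁ (pt≡pm , _) = contradiction (p-inj t m (m<n⇒m<1+n t<m) (n<1+n m) pt≡pm) (<⇒≢ t<m)
    ...   | inj₂ (pt≡p0 , pt+1≡pm) = contradiction (subst (2 ≤_) m≡1 2≤m) λ { (s≤s ()) }
      where
      m≡1 : m ≡ 1
      m≡1 = trans (sym (p-inj (suc t) m (s≤s t<m) (n<1+n m) pt+1≡pm))
                  (cong suc (p-inj t 0 (m<n⇒m<1+n t<m) z<s pt≡p0))

    crossings : count m (λ t → crosses C (p t) (p (suc t))) ≤ 2
    crossings = begin
      count m (λ t → crosses C (p t) (p (suc t)))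
        ≤⟨ count-injection m (suc m) {Q = D-crosses} (λ t → (s + t) % suc m) into injective ⟩
      count (suc m) (λ t → crosses C (cyclic m f t) (cyclic m f (suc t))) ≡⟨ crossing-cyclic C m f ⟨
      crossing C (record { len = suc m ; verts = f })                       ≤⟨ D-crossings ⟩
      2                                                                     ∎
      where
      open ≤-Reasoning
      D-crosses : ℕ → Bool
      D-crosses t = crosses C (cyclic m f t) (cyclic m f (suc t))
      into : MapsInto m (λ t → crosses C (p t) (p (suc t))) (suc m) D-crosses (λ t → (s + t) % suc m)
      into t _ crossing-t = m%n<n (s + t) (suc m) ,
        trans (cong₂ (crosses C) (cyclic-%-self m f (s + t))
                                 (trans (cyclic-suc-% m f (s + t)) (cong (cyclic m f) (sym (+-suc s t)))))
              crossing-t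
      injective : InjectiveOn m (λ t → crosses C (p t) (p (suc t))) (λ t → (s + t) % suc m)
      injective t t' t<m t'<m _ _ e = [s+t]%n-cancelˡ s e (m<n⇒m<1+n t<m) (m<n⇒m<1+n t'<m)

    degree-sum-≤ : ∀ {a b} → p 0 ≡ cv a → p m ≡ cv b →
                   count c (neighbourOnC (cv a)) + count c (neighbourOnC (cv b)) ≤ c
    degree-sum-≤ {a} {b} p0≡a pm≡b =
      LongPath.degree-sum-≤ no-longer m p 2≤m (s≤s⁻¹ c<m+1) p-inj p-path a b p0≡a pm≡b crossings

    orient : SameEdge (cv u) (cv v) (p m) (p 0) →
             count c (neighbourOnC (cv u)) + count c (neighbourOnC (cv v)) ≤ c
    orient (inj₁ (pm≡u , p0≡v)) =
      subst (_≤ c) (+-comm (count c (neighbourOnC (cv v))) _) (degree-sum-≤ p0≡v pm≡u)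
    orient (inj₂ (pm≡v , p0≡u)) = degree-sum-≤ p0≡u pm≡v

  no-longer-after-adding : NoLongerCycle G C → ∀ (u v : Fin c) →
    c < count c (neighbourOnC (cv u)) + count c (neighbourOnC (cv v)) →
    (H : Graph n) → (∀ a b → adj H a b ≡ true → adj G a b ≡ true ⊎ SameEdge (cv u) (cv v) a b) →
    NoLongerCycle H C
  no-longer-after-adding no-longer u v dense H H⊆G+uv (record { len = zero } , (() , _) , _)
  no-longer-after-adding no-longer u v dense H H⊆G+uv
    (D@record { len = suc m ; verts = f } , D-cycle@(3≤m+1 , f-inj , f-edge) , longer , D-crossings)
    with Fin.any? (λ i → sameEdge (cv u) (cv v) (f i) (cyclic m f (suc (toℕ i))) Bool.≟ true)
  ... | yes (i₀ , uv-edge) = <⇒≱ dense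
    (longer-cycle-through-edge⇒degree-sum-≤ no-longer u v H H⊆G+uv f D-cycle longer D-crossings i₀
      (sameEdge⇒SameEdge _ _ _ _ uv-edge))
  ... | no avoids-uv = no-longer (D , (3≤m+1 , f-inj , G-edge) , longer , D-crossings)
    where
    G-edge : ∀ i → adj G (f i) (cyclic m f (suc (toℕ i))) ≡ true
    G-edge i with H⊆G+uv _ _ (f-edge i)
    ... | inj₁ in-G = in-G
    ... | inj₂ uv-edge = contradiction (i , SameEdge⇒sameEdge _ _ _ _ uv-edge) avoids-uv

-- The C-closure

closure-keeps-edges : ∀ {k m} {K K' : Graph k} → Star (Step m) K K' →
  ∀ {i j} → adj K i j ≡ true → adj K' i j ≡ true
closure-keeps-edges ε                                   Kij = Kij
closure-keeps-edges ((_ , _ , _ , _ , _ , K₁≡K+uv) ◅ steps) Kij =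
  closure-keeps-edges steps (trans (K₁≡K+uv _ _) (cong (_∨ _) Kij))

module Closure {n} (G : Graph n) {c₀ : ℕ} (cv : Fin (suc c₀) → Fin n)
               (cv-inj : ∀ i j → cv i ≡ cv j → i ≡ j) where

  c : ℕ
  c = suc c₀

  C : Cyc n
  C = record { len = c ; verts = cv }

  GluedTo : Graph c → Graph n → Set
  GluedTo K H = (∀ i j → adj H (cv i) (cv j) ≡ adj K i j) ×
                (∀ x y → (inV C x ∧ inV C y) ≡ false → adj H x y ≡ adj G x y)

  -- Quantifying over every H glued to K lets a step pass to H minus the new edge.
  Invariant : Graph c → Set
  Invariant K = ∀ H → GluedTo K H → NoLongerCycle H C

  glued-to-induced : ∀ {H} → GluedTo (induced G C) H → ∀ x y → adj H x y ≡ adj G x y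
  glued-to-induced (on-C , off-C) x y with inV C x in x∈C | inV C y in y∈C
  ... | true  | true  with inV⇒verts C x∈C | inV⇒verts C y∈C
  ...   | i , refl | j , refl = on-C i j
  glued-to-induced (on-C , off-C) x y | true  | false = off-C x y (cong₂ _∧_ x∈C y∈C)
  glued-to-induced (on-C , off-C) x y | false | _     = off-C x y (cong (_∧ inV C y) x∈C)

  invariant-induced : NoLongerCycle G C → Invariant (induced G C)
  invariant-induced no-longer H glued =
    NoLongerCycle-cong {G = G} {H} {C} (glued-to-induced {H} glued) no-longer

  ⌊cv≟cv⌋ : ∀ i j → ⌊ cv i ≟ cv j ⌋ ≡ ⌊ i ≟ j ⌋
  ⌊cv≟cv⌋ i j with i ≟ j | cv i ≟ cv j
  ... | yes _    | yes _        = refl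
  ... | yes refl | no cvi≢cvi   = contradiction refl cvi≢cvi
  ... | no i≢j   | yes cvi≡cvj  = contradiction (cv-inj i j cvi≡cvj) i≢j
  ... | no _     | no _         = refl

  sameEdge-cv : ∀ u v i j → sameEdge (cv u) (cv v) (cv i) (cv j) ≡ sameEdge u v i j
  sameEdge-cv u v i j rewrite ⌊cv≟cv⌋ i u | ⌊cv≟cv⌋ j v | ⌊cv≟cv⌋ i v | ⌊cv≟cv⌋ j u = refl

  invariant-step : ∀ {K K'} → Step (suc c) K K' → Invariant K → Invariant K'
  invariant-step {K} {K'} (u , v , _ , K-uv , dense , K'≡K+uv) invariant H' (on-C' , off-C') =
    no-longer-after-adding (invariant H (on-C , off-C)) u v dense′ H' H'⊆H+uv
    where
    H : Graph n
    H = removeEdge H' (cv u) (cv v)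

    open OnCycle H cv cv-inj using (no-longer-after-adding; neighbourOnC)

    K-avoids-uv : ∀ i j → sameEdge u v i j ≡ true → adj K i j ≡ false
    K-avoids-uv i j uv with sameEdge⇒SameEdge u v i j uv
    ... | inj₁ (refl , refl) = K-uv
    ... | inj₂ (refl , refl) = trans (Graph.sym K v u) K-uv

    on-C : ∀ i j → adj H (cv i) (cv j) ≡ adj K i j
    on-C i j = begin
      adj H' (cv i) (cv j) ∧ not (sameEdge (cv u) (cv v) (cv i) (cv j))
        ≡⟨ cong₂ (λ a b → a ∧ not b) (trans (on-C' i j) (K'≡K+uv i j)) (sameEdge-cv u v i j) ⟩
      (adj K i j ∨ sameEdge u v i j) ∧ not (sameEdge u v i j)
        ≡⟨ ∨-∧-not-cancel (adj K i j) _ (K-avoids-uv i j) ⟩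
      adj K i j ∎
      where open ≡-Reasoning

    off-C : ∀ x y → (inV C x ∧ inV C y) ≡ false → adj H x y ≡ adj G x y
    off-C x y outside with sameEdge (cv u) (cv v) x y in uv
    ... | false = trans (∧-identityʳ _) (off-C' x y outside)
    ... | true with sameEdge⇒SameEdge _ _ x y uv
    ...   | inj₁ (refl , refl) =
      contradiction (trans (sym outside) (cong₂ _∧_ (inV-verts C u) (inV-verts C v))) λ ()
    ...   | inj₂ (refl , refl) =
      contradiction (trans (sym outside) (cong₂ _∧_ (inV-verts C v) (inV-verts C u))) λ ()

    H'⊆H+uv : ∀ a b → adj H' a b ≡ true → adj H a b ≡ true ⊎ SameEdge (cv u) (cv v) a b
    H'⊆H+uv a b H'ab with sameEdge (cv u) (cv v) a b in uv
    ... | false = inj₁ (trans (∧-identityʳ _) H'ab)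
    ... | true  = inj₂ (sameEdge⇒SameEdge _ _ a b uv)

    degree : ∀ w → deg K w ≡ count c (neighbourOnC (cv w))
    degree w = length-filterᵇ-tabulate c (λ i → i) (adj K w) (neighbourOnC (cv w))
      (λ i → trans (sym (on-C w i)) (cong (adj H (cv w)) (sym (cyclic-toℕ c₀ cv i))))

    dense′ : c < count c (neighbourOnC (cv u)) + count c (neighbourOnC (cv v))
    dense′ = subst (c <_) (cong₂ _+_ (degree u) (degree v)) dense

  closure-preserves : ∀ {K K'} → Star (Step (suc c)) K K' → Invariant K → Invariant K'
  closure-preserves ε              invariant = invariant
  closure-preserves {K} (_◅_ {j = K₁} step steps) invariant =
    closure-preserves steps (invariant-step {K} {K₁} step invariant)

lemma2p5 : ∀ {n} (G : Graph n) (C : Cyc n) (H : Graph n) →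
    LocallyMaximal G C → IsCClosure G C H → LocallyMaximal H C
lemma2p5 G record { len = zero } H ((() , _) , _) _
lemma2p5 G record { len = suc c₀ ; verts = cv } H ((3≤c , cv-inj , C-edges) , no-longer)
         (K , (steps , _) , on-C , off-C) =
  (3≤c , cv-inj , λ i → trans (on-C i (next i)) (closure-keeps-edges steps (C-edges i))) ,
  closure-preserves steps (invariant-induced no-longer) H (on-C , off-C)
  where open Closure G cv cv-inj
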